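{- Let $G$ be a graph of treedepth $k$. Then $\chi_c^{\bullet}(G)\leq k$, and hence $G$ is weighted $\frac{1}{k}$-flexibly $k$-choosable.
   Context: All graphs are finite and simple. The treedepth $td(G)$ of a connected graph $G$ is the minimum integer $t$ such that some supergraph of $G$ has a spanning rooted tree of height $t$ (a tree consisting of a single vertex has height $1$) such that every edge of $G$ joins an ancestor-descendant pair of the tree; for disconnected $G$ it is the maximum treedepth of its components. A correspondence-cover of a graph $G$ is a pair $(L,H)$ where $H$ is a graph and $L:V(G)\to 2^{V(H)}$ satisfies: the sets $L(v)$, $v\in V(G)$, partition $V(H)$; each $L(v)$ induces a clique in $H$; if $uv\notin E(G)$ ($u\ne v$) there are no edges of $H$ between $L(u)$ and $L(v)$; if $uv\in E(G)$ the edges of $H$ between $L(u)$ and $L(v)$ form a matching. It is $k$-fold if $|L(v)|=k$ for all $v$. An independent transversal of $(L,H)$ is an independent set $I$ of $H$ with $|I\cap L(v)|=1$ for every $v$. The cover admits a fractional packing if there is a probability distribution on independent transversals $I$ such that $\mathbb{P}(x\in I)\ge 1/|L(v)|$ for every $v\in V(G)$ and every $x\in L(v)$. The fractional correspondence packing number $\chi_c^{\bullet}(G)$ is the least integer $k$ such that every $k$-fold correspondence-cover of $G$ admits a fractional packing. A graph $G$ is weighted $\epsilon$-flexibly $k$-choosable if for every list-assignment $L$ with $|L(v)|=k$ for all $v$ there is a probability distribution on proper $L$-colourings $c$ of $G$ (i.e. $c(v)\in L(v)$ and $c(u)\ne c(v)$ for adjacent $u,v$) such that $\mathbb{P}(c(v)=x)\ge\epsilon$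 for every vertex $v$ and every $x\in L(v)$. -}

module Defs where

open import Data.Bool using (Bool; true; false)
open import Data.Nat using (ℕ; suc; _≤_; NonZero; _≡ᵇ_)
open import Data.Fin using (Fin; _≟_)
open import Data.Maybe using (Maybe; just; nothing)
open import Data.Product using (Σ; Σ-syntax; _×_; _,_; proj₁; proj₂)
open import Data.Sum using (_⊎_)
open import Data.List using (List; []; _∷_; foldr; map)
open import Data.List.Relation.Unary.All using (All)
open import Data.Integer using (+_)
open import Data.Rational using (ℚ; 0ℚ; 1ℚ; _+_; _*_; _/_) renaming (_≤_ to _≤ℚ_)
open import Relation.Nullary using (¬_)
open import Relation.Nullary.Decidable using (⌊_⌋)
open import Relation.Binary.PropositionalEquality using (_≡_; _≢_)

record Graph : Set where
  field
    n      : ℕ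
    adj    : Fin n → Fin n → Bool
    sym    : ∀ u v → adj u v ≡ adj v u
    irrefl : ∀ v → adj v v ≡ false

open Graph public

-- A rooted forest on V(G) is given by a parent map; the depth function
-- (roots have depth 1, children one more than their parent) witnesses
-- acyclicity.

record RootedForest (G : Graph) : Set where
  field
    parent     : Fin (n G) → Maybe (Fin (n G))
    depth      : Fin (n G) → ℕ
    depth-root  : ∀ v → parent v ≡ nothing → depth v ≡ 1
    depth-child : ∀ v p → parent v ≡ just p → depth v ≡ suc (depth p)

open RootedForest public

data Ancestor {G : Graph} (F : RootedForest G) (u : Fin (n G)) : Fin (n G) → Set where
  here  : Ancestor F u u
  there : ∀ {v p} → parent F v ≡ just p → Ancestor F u p → Ancestor F u v

ElimForest : (G : Graph) → RootedForest G → Set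
ElimForest G F = ∀ u v → adj G u v ≡ true → Ancestor F u v ⊎ Ancestor F v u

HeightAtMost : {G : Graph} → RootedForest G → ℕ → Set
HeightAtMost {G} F t = ∀ v → depth F v ≤ t

TreedepthAtMost : Graph → ℕ → Set
TreedepthAtMost G t = Σ[ F ∈ RootedForest G ] (ElimForest G F × HeightAtMost F t)

HasTreedepth : Graph → ℕ → Set
HasTreedepth G k = TreedepthAtMost G k × (∀ t → TreedepthAtMost G t → k ≤ t)

sumℚ : List ℚ → ℚ
sumℚ = foldr _+_ 0ℚ

record Dist (A : Set) : Set where
  field
    support : List (A × ℚ)
    nonneg  : All (λ p → 0ℚ ≤ℚ proj₂ p) support
    total   : sumℚ (map proj₂ support) ≡ 1ℚ

open Dist public

weightIf : {A : Set} → (A → Bool) → A × ℚ → ℚ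
weightIf E (a , q) with E a
... | true  = q
... | false = 0ℚ

Prob : {A : Set} → Dist A → (A → Bool) → ℚ
Prob D E = sumℚ (map (weightIf E) (support D))

ℕtoℚ : ℕ → ℚ
ℕtoℚ k = (+ k) / 1

-- k-fold correspondence covers.  V(H) = Fin n × Fin k, L(v) = {v} × Fin k.

record Cover (G : Graph) (k : ℕ) : Set where
  field
    hadj     : Fin (n G) → Fin k → Fin (n G) → Fin k → Bool
    hsym     : ∀ u i v j → hadj u i v j ≡ hadj v j u i
    hirrefl  : ∀ v i → hadj v i v i ≡ false
    clique   : ∀ v i j → i ≢ j → hadj v i v j ≡ true
    nonadj   : ∀ u v → u ≢ v → adj G u v ≡ false → ∀ i j → hadj u i v j ≡ false
    matchingˡ : ∀ u v → adj G u v ≡ true → ∀ i j j′ →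
                hadj u i v j ≡ true → hadj u i v j′ ≡ true → j ≡ j′
    matchingʳ : ∀ u v → adj G u v ≡ true → ∀ i i′ j →
                hadj u i v j ≡ true → hadj u i′ v j ≡ true → i ≡ i′

open Cover public

IndepTransversal : {G : Graph} {k : ℕ} → Cover G k → Set
IndepTransversal {G} {k} C =
  Σ[ t ∈ (Fin (n G) → Fin k) ] (∀ u v → hadj C u (t u) v (t v) ≡ false)

-- P(x ∈ I) ≥ 1/|L(v)| = 1/k, written as k · P(x ∈ I) ≥ 1
FractionalPacking : {G : Graph} {k : ℕ} → Cover G k → Set
FractionalPacking {G} {k} C =
  Σ[ D ∈ Dist (IndepTransversal C) ]
    (∀ v (i : Fin k) → 1ℚ ≤ℚ ℕtoℚ k * Prob D (λ I → ⌊ proj₁ I v ≟ i ⌋))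

EveryCoverPacks : Graph → ℕ → Set
EveryCoverPacks G k = (C : Cover G k) → FractionalPacking C

-- χ_c^•(G) ≤ k : the least k₀ with EveryCoverPacks G k₀ is ≤ k
FracCorrPackingAtMost : Graph → ℕ → Set
FracCorrPackingAtMost G k = Σ[ j ∈ ℕ ] (j ≤ k × EveryCoverPacks G j)

-- Weighted ε-flexible k-choosability. Colours are natural numbers;
-- a list of size k is an injective map Fin k → ℕ.

ListAssignment : Graph → ℕ → Set
ListAssignment G k =
  Σ[ L ∈ (Fin (n G) → Fin k → ℕ) ] (∀ v i j → L v i ≡ L v j → i ≡ j)

ProperLColouring : (G : Graph) {k : ℕ} → ListAssignment G k → Set
ProperLColouring G {k} (L , _) =
  Σ[ c ∈ (Fin (n G) → ℕ) ]
    ((∀ v → Σ[ i ∈ Fin k ] L v i ≡ c v) ×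
     (∀ u v → adj G u v ≡ true → c u ≢ c v))

WeightedFlexChoosable : Graph → ℚ → ℕ → Set
WeightedFlexChoosable G ε k =
  (LA : ListAssignment G k) →
  Σ[ D ∈ Dist (ProperLColouring G LA) ]
    (∀ v (i : Fin k) → ε ≤ℚ Prob D (λ c → proj₁ c v ≡ᵇ proj₁ LA v i))

-- Take an elimination forest of height at most k and colour it level by level.  When level
-- j + 1 is coloured, each of its vertices has k − j colours left and tries each of them in
-- turn.  A deeper vertex v is adjacent at that level only to its ancestor, so it loses at
-- most the colour matched to the ancestor's choice; completing these matchings to injections
-- makes v lose each of its colours in exactly one of the k − j branches.  Taken uniformly,
-- the k! independent transversals so obtained pick every colour with probability at least
-- 1/k.  A list assignment defines a cover whose independent transversals are proper list
-- colourings, which gives the second claim.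
module Submission where

open import Defs hiding (sym)
open import Data.Nat using (ℕ; NonZero)
open import Data.Product using (_×_)
open import Data.Integer using (+_)
open import Data.Rational using (_/_)

open import Data.Bool using (Bool; true; false; not; _∧_; T)
import Data.Bool.Properties as Bool
open import Data.Empty using (⊥-elim)
open import Data.Fin as Fin using (Fin; zero; suc; punchIn; punchOut; fromℕ<)
import Data.Fin.Properties as Fin
open import Data.Fin.Permutation.Components using (transpose; transpose-inverse)
import Data.Integer.Base as ℤ
import Data.Integer.Properties as ℤ
open import Data.List using (List; []; _∷_; _++_; map; length; allFin; [_])
open import Data.List.Properties using (map-∘; map-cong; length-++)
open import Data.List.Membership.Propositional using (_∈_)
open import Data.List.Membership.Propositional.Properties using (∈-allFin)
open import Data.List.Relation.Unary.All as All using (All; []; _∷_)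
open import Data.List.Relation.Unary.All.Properties using (map⁺; ++⁺)
open import Data.List.Relation.Unary.Any using (here; there)
open import Data.Maybe using (just; nothing)
open import Data.Nat as ℕ using (zero; suc; _+_; _*_; _∸_; _≤_; _<_; _!; z≤n; s≤s; _≡ᵇ_)
open import Data.Nat.Coprimality using (Coprime; 1-coprimeTo) renaming (sym to coprime-sym)
import Data.Nat.Properties as ℕ
open import Algebra.Properties.Semiring.Sum ℕ.+-*-semiring using (sum; sum-remove; *-distribˡ-sum)
open import Data.Product as Product using (Σ-syntax; _,_; proj₁; proj₂)
open import Data.Rational as ℚ using (ℚ; mkℚ; 1ℚ; toℚᵘ) renaming (_≤_ to _≤ℚ_)
import Data.Rational.Properties as ℚ
import Data.Rational.Unnormalised as ℚᵘ
import Data.Rational.Unnormalised.Properties as ℚᵘ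
open import Data.Sum using (inj₁; inj₂)
open import Data.Vec.Functional as Vector using (Vector)
open import Function using (_∘_; id; Injective; mk⇔)
open import Relation.Nullary using (Dec; does; yes; no)
open import Relation.Nullary.Decidable
  using (⌊_⌋; _×-dec_; dec-true; dec-false; does-⇔; isYes≗does)
open import Relation.Binary.PropositionalEquality
  using (_≡_; _≢_; refl; sym; trans; cong; cong₂; subst; module ≡-Reasoning)

ℕtoℚᵘ : ℕ → ℚᵘ.ℚᵘ
ℕtoℚᵘ n = ℚᵘ.mkℚᵘ (+ n) 0

toℚᵘ-ℕtoℚ : ∀ n → toℚᵘ (ℕtoℚ n) ℚᵘ.≃ ℕtoℚᵘ n
toℚᵘ-ℕtoℚ n = ℚ.toℚᵘ-fromℚᵘ (ℕtoℚᵘ n)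

ℕtoℚ-+ : ∀ m n → ℕtoℚ (m + n) ≡ ℕtoℚ m ℚ.+ ℕtoℚ n
ℕtoℚ-+ m n = ℚ.toℚᵘ-injective (begin
  toℚᵘ (ℕtoℚ (m + n))              ≈⟨ toℚᵘ-ℕtoℚ (m + n) ⟩
  ℕtoℚᵘ (m + n)                    ≈⟨ ℚᵘ.*≡* (cong (ℤ._* + 1) ℕtoℤ-+) ⟩
  ℕtoℚᵘ m ℚᵘ.+ ℕtoℚᵘ n             ≈⟨ ℚᵘ.+-cong (toℚᵘ-ℕtoℚ m) (toℚᵘ-ℕtoℚ n) ⟨
  toℚᵘ (ℕtoℚ m) ℚᵘ.+ toℚᵘ (ℕtoℚ n) ≈⟨ ℚ.toℚᵘ-homo-+ (ℕtoℚ m) (ℕtoℚ n) ⟨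
  toℚᵘ (ℕtoℚ m ℚ.+ ℕtoℚ n)         ∎)
  where
  open ℚᵘ.≃-Reasoning
  ℕtoℤ-+ : + (m + n) ≡ + m ℤ.* + 1 ℤ.+ + n ℤ.* + 1
  ℕtoℤ-+ = trans (ℤ.pos-+ m n)
                 (sym (cong₂ ℤ._+_ (ℤ.*-identityʳ (+ m)) (ℤ.*-identityʳ (+ n))))

ℕtoℚ-* : ∀ m n → ℕtoℚ (m * n) ≡ ℕtoℚ m ℚ.* ℕtoℚ n
ℕtoℚ-* m n = ℚ.toℚᵘ-injective (begin
  toℚᵘ (ℕtoℚ (m * n))              ≈⟨ toℚᵘ-ℕtoℚ (m * n) ⟩
  ℕtoℚᵘ (m * n)                    ≈⟨ ℚᵘ.*≡* (cong (ℤ._* + 1) (ℤ.pos-* m n)) ⟩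
  ℕtoℚᵘ m ℚᵘ.* ℕtoℚᵘ n             ≈⟨ ℚᵘ.*-cong (toℚᵘ-ℕtoℚ m) (toℚᵘ-ℕtoℚ n) ⟨
  toℚᵘ (ℕtoℚ m) ℚᵘ.* toℚᵘ (ℕtoℚ n) ≈⟨ ℚ.toℚᵘ-homo-* (ℕtoℚ m) (ℕtoℚ n) ⟨
  toℚᵘ (ℕtoℚ m ℚ.* ℕtoℚ n)         ∎)
  where open ℚᵘ.≃-Reasoning

ℕtoℚ-mono-≤ : ∀ {m n} → m ≤ n → ℕtoℚ m ≤ℚ ℕtoℚ n
ℕtoℚ-mono-≤ {m} {n} m≤n = ℚ.toℚᵘ-cancel-≤ (begin
  toℚᵘ (ℕtoℚ m) ≃⟨ toℚᵘ-ℕtoℚ m ⟩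
  ℕtoℚᵘ m       ≤⟨ ℚᵘ.*≤* (ℤ.*-monoʳ-≤-nonNeg (+ 1) (ℤ.+≤+ m≤n)) ⟩
  ℕtoℚᵘ n       ≃⟨ toℚᵘ-ℕtoℚ n ⟨
  toℚᵘ (ℕtoℚ n) ∎)
  where open ℚᵘ.≤-Reasoning

-- Both factors are already in lowest terms: they are n/1 and its reciprocal.
ℕtoℚ-*-inverse : ∀ n .{{_ : NonZero n}} → ℕtoℚ n ℚ.* (+ 1 / n) ≡ 1ℚ
ℕtoℚ-*-inverse n@(suc _) = begin
  ℕtoℚ n ℚ.* (+ 1 / n) ≡⟨ cong₂ ℚ._*_ (ℚ.normalize-coprime n⊥1)
                                      (ℚ.normalize-coprime (coprime-sym n⊥1)) ⟩
  p ℚ.* ℚ.1/ p         ≡⟨ ℚ.*-inverseʳ p ⟩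
  1ℚ                   ∎
  where
  open ≡-Reasoning
  n⊥1 : Coprime n 1
  n⊥1 = coprime-sym (1-coprimeTo n)
  p : ℚ
  p = mkℚ (+ n) 0 n⊥1

1/n-nonNeg : ∀ n .{{_ : NonZero n}} → ℚ.NonNegative (+ 1 / n)
1/n-nonNeg n = ℚ.normalize-nonNeg 1 n

1≤n*p⇒1/n≤p : ∀ n .{{_ : NonZero n}} {p} → 1ℚ ≤ℚ ℕtoℚ n ℚ.* p → + 1 / n ≤ℚ p
1≤n*p⇒1/n≤p n {p} 1≤np = begin
  1/n                    ≡⟨ ℚ.*-identityʳ 1/n ⟨
  1/n ℚ.* 1ℚ             ≤⟨ ℚ.*-monoˡ-≤-nonNeg 1/n {{1/n-nonNeg n}} 1≤np ⟩
  1/n ℚ.* (ℕtoℚ n ℚ.* p) ≡⟨ ℚ.*-assoc 1/n (ℕtoℚ n) p ⟨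
  1/n ℚ.* ℕtoℚ n ℚ.* p   ≡⟨ cong (ℚ._* p) (ℚ.*-comm 1/n (ℕtoℚ n)) ⟩
  ℕtoℚ n ℚ.* 1/n ℚ.* p   ≡⟨ cong (ℚ._* p) (ℕtoℚ-*-inverse n) ⟩
  1ℚ ℚ.* p               ≡⟨ ℚ.*-identityˡ p ⟩
  p                      ∎
  where
  open ℚ.≤-Reasoning
  1/n = + 1 / n

count : {A : Set} → (A → Bool) → List A → ℕ
count E []       = 0
count E (x ∷ xs) with E x
... | true  = suc (count E xs)
... | false = count E xs

count-++ : {A : Set} (E : A → Bool) (xs ys : List A) →
  count E (xs ++ ys) ≡ count E xs + count E ys
count-++ E []       ys = refl
count-++ E (x ∷ xs) ys with E x
... | true  = cong suc (count-++ E xs ys)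
... | false = count-++ E xs ys

count-true : {A : Set} (xs : List A) → count (λ _ → true) xs ≡ length xs
count-true []       = refl
count-true (x ∷ xs) = cong suc (count-true xs)

count-All : {A : Set} (E : A → Bool) {xs : List A} →
  All (λ x → E x ≡ true) xs → count E xs ≡ length xs
count-All E []                  = refl
count-All E {x ∷ _} (Ex ∷ Exs) with E x
count-All E (refl ∷ Exs) | true = cong suc (count-All E Exs)

weighted : {A : Set} → ℚ → List A → List (A × ℚ)
weighted q = map (_, q)

sumℚ-weighted : {A : Set} (E : A → Bool) (q : ℚ) (xs : List A) →
  sumℚ (map (weightIf E) (weighted q xs)) ≡ ℕtoℚ (count E xs) ℚ.* q
sumℚ-weighted E q []       = sym (ℚ.*-zeroˡ q)
sumℚ-weighted E q (x ∷ xs) with E x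
... | false = trans (ℚ.+-identityˡ _) (sumℚ-weighted E q xs)
... | true  = begin
  q ℚ.+ sumℚ (map (weightIf E) (weighted q xs)) ≡⟨ cong (q ℚ.+_) (sumℚ-weighted E q xs) ⟩
  q ℚ.+ ℕtoℚ c ℚ.* q                           ≡⟨ cong (ℚ._+ ℕtoℚ c ℚ.* q) (ℚ.*-identityˡ q) ⟨
  1ℚ ℚ.* q ℚ.+ ℕtoℚ c ℚ.* q                    ≡⟨ ℚ.*-distribʳ-+ q 1ℚ (ℕtoℚ c) ⟨
  (1ℚ ℚ.+ ℕtoℚ c) ℚ.* q                        ≡⟨ cong (ℚ._* q) (ℕtoℚ-+ 1 c) ⟨
  ℕtoℚ (suc c) ℚ.* q                           ∎
  where
  open ≡-Reasoning
  c = count E xs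

uniform : {A : Set} (xs : List A) .{{_ : NonZero (length xs)}} → Dist A
uniform xs = record
  { support = weighted q xs
  ; nonneg  = map⁺ (All.universal (λ _ → ℚ.nonNegative⁻¹ q {{1/n-nonNeg (length xs)}}) xs)
  -- map proj₂ and map (weightIf (λ _ → true)) agree definitionally
  ; total   = begin
      sumℚ (map proj₂ (weighted q xs))   ≡⟨ sumℚ-weighted (λ _ → true) q xs ⟩
      ℕtoℚ (count (λ _ → true) xs) ℚ.* q ≡⟨ cong (λ c → ℕtoℚ c ℚ.* q) (count-true xs) ⟩
      ℕtoℚ (length xs) ℚ.* q             ≡⟨ ℕtoℚ-*-inverse (length xs) ⟩
      1ℚ                                 ∎
  }
  where
  open ≡-Reasoning
  q = + 1 / length xs

1≤n*Prob-uniform : {A : Set} (xs : List A) .{{_ : NonZero (length xs)}} (E : A → Bool) (n : ℕ) →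
  length xs ≤ n * count E xs → 1ℚ ≤ℚ ℕtoℚ n ℚ.* Prob (uniform xs) E
1≤n*Prob-uniform xs E n len≤n*c = begin
  1ℚ                             ≡⟨ ℕtoℚ-*-inverse (length xs) ⟨
  ℕtoℚ (length xs) ℚ.* q         ≤⟨ ℚ.*-monoʳ-≤-nonNeg q {{1/n-nonNeg (length xs)}}
                                                        (ℕtoℚ-mono-≤ len≤n*c) ⟩
  ℕtoℚ (n * c) ℚ.* q             ≡⟨ cong (ℚ._* q) (ℕtoℚ-* n c) ⟩
  ℕtoℚ n ℚ.* ℕtoℚ c ℚ.* q        ≡⟨ ℚ.*-assoc (ℕtoℚ n) (ℕtoℚ c) q ⟩
  ℕtoℚ n ℚ.* (ℕtoℚ c ℚ.* q)      ≡⟨ cong (ℕtoℚ n ℚ.*_) (sumℚ-weighted E q xs) ⟨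
  ℕtoℚ n ℚ.* Prob (uniform xs) E ∎
  where
  open ℚ.≤-Reasoning
  q = + 1 / length xs
  c = count E xs

mapDist : {A B : Set} → (A → B) → Dist A → Dist B
mapDist f D = record
  { support = map (Product.map₁ f) (support D)
  ; nonneg  = map⁺ (nonneg D)
  ; total   = trans (cong sumℚ (sym (map-∘ (support D)))) (total D)
  }

Prob-mapDist : {A B : Set} (f : A → B) (D : Dist A) {E : B → Bool} {E′ : A → Bool} →
  (∀ a → E (f a) ≡ E′ a) → Prob (mapDist f D) E ≡ Prob D E′
Prob-mapDist f D {E} {E′} E∘f≗E′ =
  cong sumℚ (trans (sym (map-∘ (support D))) (map-cong weightIf-map₁ (support D)))
  where
  weightIf-map₁ : ∀ p → weightIf E (Product.map₁ f p) ≡ weightIf E′ p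
  weightIf-map₁ (a , q) with E (f a) | E′ a | E∘f≗E′ a
  ... | true  | true  | refl = refl
  ... | false | false | refl = refl

concatᶠ : {A : Set} {s : ℕ} → Vector (List A) s → List A
concatᶠ = Vector.foldr _++_ []

length-concatᶠ : {A : Set} {s : ℕ} (xss : Vector (List A) s) →
  length (concatᶠ xss) ≡ sum (length ∘ xss)
length-concatᶠ {s = zero}  xss = refl
length-concatᶠ {s = suc s} xss =
  trans (length-++ (xss zero)) (cong (length (xss zero) ℕ.+_) (length-concatᶠ (xss ∘ suc)))

count-concatᶠ : {A : Set} {s : ℕ} (E : A → Bool) (xss : Vector (List A) s) →
  count E (concatᶠ xss) ≡ sum (count E ∘ xss)
count-concatᶠ {s = zero}  E xss = refl
count-concatᶠ {s = suc s} E xss =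
  trans (count-++ E (xss zero) _) (cong (count E (xss zero) ℕ.+_) (count-concatᶠ E (xss ∘ suc)))

All-concatᶠ : {A : Set} {P : A → Set} {s : ℕ} (xss : Vector (List A) s) →
  (∀ i → All P (xss i)) → All P (concatᶠ xss)
All-concatᶠ {s = zero}  xss all = []
All-concatᶠ {s = suc s} xss all = ++⁺ (all zero) (All-concatᶠ (xss ∘ suc) (all ∘ suc))

sum-const : ∀ {s} (f : Vector ℕ s) {x} → (∀ i → f i ≡ x) → sum f ≡ s * x
sum-const {zero}  f f≡x = refl
sum-const {suc s} f f≡x = cong₂ _+_ (f≡x zero) (sum-const (f ∘ suc) (f≡x ∘ suc))

≤sum : ∀ {s} (f : Vector ℕ (suc s)) i → f i ≤ sum f
≤sum f i = ℕ.≤-trans (ℕ.m≤m+n (f i) _) (ℕ.≤-reflexive (sym (sum-remove f)))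

*≤sum : ∀ {s} (f : Vector ℕ s) {x} → (∀ i → x ≤ f i) → s * x ≤ sum f
*≤sum {zero}  f x≤f = z≤n
*≤sum {suc s} f x≤f = ℕ.+-mono-≤ (x≤f zero) (*≤sum (f ∘ suc) (x≤f ∘ suc))

*≤sum-except : ∀ {s} (f : Vector ℕ (suc s)) (i₀ : Fin (suc s)) {x} →
  (∀ i → i ≢ i₀ → x ≤ f i) → s * x ≤ sum f
*≤sum-except {s} f i₀ {x} x≤f = begin
  s * x                             ≤⟨ *≤sum (Vector.removeAt f i₀) x≤f∘punchIn ⟩
  sum (Vector.removeAt f i₀)        ≤⟨ ℕ.m≤n+m _ (f i₀) ⟩
  f i₀ + sum (Vector.removeAt f i₀) ≡⟨ sum-remove f ⟨
  sum f                             ∎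
  where
  open ℕ.≤-Reasoning
  x≤f∘punchIn : ∀ i → x ≤ f (punchIn i₀ i)
  x≤f∘punchIn i = x≤f (punchIn i₀ i) (Fin.punchInᵢ≢i i₀ i)

transpose-matchˡ : ∀ {s} (a b : Fin s) → transpose a b a ≡ b
transpose-matchˡ a b rewrite dec-true (a Fin.≟ a) refl = refl

transpose-fix : ∀ {s} {a b c : Fin s} → c ≢ a → c ≢ b → transpose a b c ≡ c
transpose-fix {a = a} {b} {c} c≢a c≢b
  rewrite dec-false (c Fin.≟ a) c≢a | dec-false (c Fin.≟ b) c≢b = refl

transpose-injective : ∀ {s} (a b : Fin s) → Injective _≡_ _≡_ (transpose a b)
transpose-injective a b {c} {d} eq = begin
  c                               ≡⟨ transpose-inverse b a ⟨
  transpose b a (transpose a b c) ≡⟨ cong (transpose b a) eq ⟩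
  transpose b a (transpose a b d) ≡⟨ transpose-inverse b a ⟩
  d                               ∎
  where open ≡-Reasoning

module _ {s : ℕ} {R : Fin s → Fin s → Set} (R? : ∀ i x → Dec (R i x))
         (R-functional : ∀ {i x y} → R i x → R i y → x ≡ y)
         (R-injective : ∀ {i i′ x} → R i x → R i′ x → i ≡ i′) where

  private
    ExtendsOn : (Fin s → Fin s) → List (Fin s) → Set
    ExtendsOn f is = ∀ {i x} → i ∈ is → R i x → f i ≡ x

    -- Matched pairs are fixed one at a time by post-composing with a transposition.
    extend-matching-on : (is : List (Fin s)) →
      Σ[ f ∈ (Fin s → Fin s) ] (Injective _≡_ _≡_ f × ExtendsOn f is)
    extend-matching-on []       = id , id , λ ()
    extend-matching-on (i ∷ is) with extend-matching-on is | Fin.any? (R? i)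
    ... | f , f-injective , f-extends | no ¬Ri = f , f-injective , extends
      where
      extends : ExtendsOn f (i ∷ is)
      extends (here refl)  Rix = ⊥-elim (¬Ri (_ , Rix))
      extends (there i′∈is)    = f-extends i′∈is
    ... | f , f-injective , f-extends | yes (x , Rix) =
      g , f-injective ∘ transpose-injective (f i) x , extends
      where
      g : Fin s → Fin s
      g = transpose (f i) x ∘ f
      extends : ExtendsOn g (i ∷ is)
      extends {i′} i′∈ Ri′y with i′ Fin.≟ i
      ... | yes refl = trans (transpose-matchˡ (f i) x) (R-functional Rix Ri′y)
      extends (here refl) _ | no i≢i = ⊥-elim (i≢i refl)
      extends {i′} {y} (there i′∈is) Ri′y | no i′≢i =
        trans (cong (transpose (f i) x) fi′≡y) (transpose-fix y≢fi y≢x)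
        where
        fi′≡y = f-extends i′∈is Ri′y
        y≢fi : y ≢ f i
        y≢fi y≡fi = i′≢i (f-injective (trans fi′≡y y≡fi))
        y≢x : y ≢ x
        y≢x refl = i′≢i (R-injective Ri′y Rix)

  extend-matching :
    Σ[ f ∈ (Fin s → Fin s) ] (Injective _≡_ _≡_ f × (∀ {i x} → R i x → f i ≡ x))
  extend-matching with extend-matching-on (allFin s)
  ... | f , f-injective , f-extends = f , f-injective , f-extends (∈-allFin _)

module EliminationForest {G : Graph} (F : RootedForest G) where

  private
    V = Fin (n G)
    d = depth F

    up : ℕ → V → V
    up zero    v = v
    up (suc t) v with parent F v
    ... | nothing = v
    ... | just p  = up t p

  depth-pos : ∀ v → 1 ≤ d v
  depth-pos v with parent F v in e
  ... | nothing = ℕ.≤-reflexive (sym (depth-root F v e))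
  ... | just p  = subst (1 ≤_) (sym (depth-child F v p e)) (s≤s z≤n)

  ancestor-depth-≤ : ∀ {u v} → Ancestor F u v → d u ≤ d v
  ancestor-depth-≤ here                  = ℕ.≤-refl
  ancestor-depth-≤ (there {v} {p} e u≼p) rewrite depth-child F v p e =
    ℕ.m≤n⇒m≤1+n (ancestor-depth-≤ u≼p)

  private
    depth-up : ∀ t v → t < d v → d (up t v) ≡ d v ∸ t
    depth-up zero    v t<dv = refl
    depth-up (suc t) v t<dv with parent F v in e
    ... | nothing =
      ⊥-elim (ℕ.<⇒≱ t<dv (ℕ.≤-trans (ℕ.≤-reflexive (depth-root F v e)) (s≤s z≤n)))
    ... | just p rewrite depth-child F v p e = depth-up t p (ℕ.≤-pred t<dv)

  ancestorAt : ℕ → V → V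
  ancestorAt t v = up (d v ∸ t) v

  depth-ancestorAt : ∀ {t v} → 1 ≤ t → t ≤ d v → d (ancestorAt t v) ≡ t
  depth-ancestorAt {t} {v} 1≤t t≤dv =
    trans (depth-up (d v ∸ t) v (ℕ.∸-monoʳ-< 1≤t t≤dv)) (ℕ.m∸[m∸n]≡n t≤dv)

  ancestor⇒≡ancestorAt : ∀ {u v} → Ancestor F u v → u ≡ ancestorAt (d u) v
  ancestor⇒≡ancestorAt {u} here rewrite ℕ.n∸n≡0 (d u) = refl
  ancestor⇒≡ancestorAt {u} (there {v} {p} e u≼p)
    rewrite depth-child F v p e | ℕ.+-∸-assoc 1 (ancestor-depth-≤ u≼p) | e =
    ancestor⇒≡ancestorAt u≼p

  ancestor∧sameDepth⇒≡ : ∀ {u v} → Ancestor F u v → d u ≡ d v → u ≡ v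
  ancestor∧sameDepth⇒≡ {u} {v} u≼v du≡dv with ancestor⇒≡ancestorAt u≼v
  ... | u≡ancestor rewrite du≡dv | ℕ.n∸n≡0 (d v) = u≡ancestor

  module _ (elim : ElimForest G F) where

    shallowerNeighbour⇒ancestorAt : ∀ {u v} → adj G u v ≡ true → d u < d v →
      u ≡ ancestorAt (d u) v
    shallowerNeighbour⇒ancestorAt {u} {v} e du<dv with elim u v e
    ... | inj₁ u≼v = ancestor⇒≡ancestorAt u≼v
    ... | inj₂ v≼u = ⊥-elim (ℕ.<⇒≱ du<dv (ancestor-depth-≤ v≼u))

    sameDepth⇒nonadjacent : ∀ {u v} → d u ≡ d v → u ≢ v → adj G u v ≡ false
    sameDepth⇒nonadjacent {u} {v} du≡dv u≢v with adj G u v in e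
    ... | false = refl
    ... | true with elim u v e
    ...   | inj₁ u≼v = ⊥-elim (u≢v (ancestor∧sameDepth⇒≡ u≼v du≡dv))
    ...   | inj₂ v≼u = ⊥-elim (u≢v (sym (ancestor∧sameDepth⇒≡ v≼u (sym du≡dv))))

adjacent⇒distinct : (G : Graph) {u v : Fin (n G)} → adj G u v ≡ true → u ≢ v
adjacent⇒distinct G {u} e refl with trans (sym e) (irrefl G u)
... | ()

hadj-true⇒adjacent : {G : Graph} {k : ℕ} (C : Cover G k) {u v : Fin (n G)} {i j : Fin k} →
  u ≢ v → hadj C u i v j ≡ true → adj G u v ≡ true
hadj-true⇒adjacent {G} C {u} {v} {i} {j} u≢v e with adj G u v in uv
... | true  = refl
... | false with trans (sym e) (nonadj C u v u≢v uv i j)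
...   | ()

<-≤-+⇒NonZero : ∀ m {n o} → m < n → n ≤ m + o → NonZero o
<-≤-+⇒NonZero m {o = zero}  m<n n≤m+0 =
  ⊥-elim (ℕ.<⇒≱ m<n (subst (_ ≤_) (ℕ.+-identityʳ m) n≤m+0))
<-≤-+⇒NonZero m {o = suc o} _   _     = _

module LevelPacking {G : Graph} {k : ℕ} (C : Cover G k) (F : RootedForest G)
                    (elim : ElimForest G F) where

  open EliminationForest F

  private
    V = Fin (n G)
    d = depth F

    <-depth⇒≢ : ∀ {u v} → d u < d v → u ≢ v
    <-depth⇒≢ du<dv refl = ℕ.<-irrefl refl du<dv

    below : ∀ {x j} → x ≤ suc j → x ≢ suc j → x ≤ j
    below x≤1+j x≢1+j = ℕ.m<1+n⇒m≤n (ℕ.≤∧≢⇒< x≤1+j x≢1+j)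

  picks : V → Fin k → IndepTransversal C → Bool
  picks v x T = ⌊ proj₁ T v Fin.≟ x ⌋

  picks-true : ∀ {v x T} → proj₁ T v ≡ x → picks v x T ≡ true
  picks-true {v} {x} {T} Tv≡x =
    trans (isYes≗does (proj₁ T v Fin.≟ x)) (dec-true (proj₁ T v Fin.≟ x) Tv≡x)

  -- Vertices of depth at most j are coloured; each deeper vertex keeps a palette of h
  -- colours compatible with that colouring.  colour is junk on the deeper vertices and
  -- palette on the others.
  record Stage (j h : ℕ) : Set where
    field
      colour             : V → Fin k
      palette            : V → Fin h → Fin k
      colour-independent : ∀ u v → d u ≤ j → d v ≤ j →
                           hadj C u (colour u) v (colour v) ≡ false
      palette-free       : ∀ u v → d u ≤ j → j < d v → ∀ m →
                           hadj C u (colour u) v (palette v m) ≡ false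
      palette-injective  : ∀ v → j < d v → Injective _≡_ _≡_ (palette v)

  Extends : ℕ → (V → Fin k) → IndepTransversal C → Set
  Extends j c T = ∀ v → d v ≤ j → proj₁ T v ≡ c v

  record UniformPacking {j h : ℕ} (S : Stage j h) : Set where
    field
      transversals : List (IndepTransversal C)
      length≡      : length transversals ≡ h !
      extends      : All (Extends j (Stage.colour S)) transversals
      covers       : ∀ v → j < d v → ∀ m →
                     h ! ≤ h * count (picks v (Stage.palette S v m)) transversals

  open UniformPacking

  -- Branch i gives every vertex at depth j + 1 its i-th palette colour.  A deeper vertex v
  -- then drops the palette index matched in C to the colour of its ancestor at depth j + 1
  -- (or a spare one); as these indices are injective in i, each colour of v survives in
  -- all branches but one.
  module Next {j h : ℕ} (S : Stage j (suc h)) where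

    open Stage S

    private
      a : V → V
      a = ancestorAt (suc j)

      depth-a : ∀ {v} → suc j < d v → d (a v) ≡ suc j
      depth-a 1+j<dv = depth-ancestorAt (s≤s z≤n) (ℕ.<⇒≤ 1+j<dv)

      Conflict : V → Fin (suc h) → Fin (suc h) → Set
      Conflict v i x = suc j < d v × hadj C (a v) (palette (a v) i) v (palette v x) ≡ true

      conflict? : ∀ v i x → Dec (Conflict v i x)
      conflict? v i x =
        (suc j ℕ.<? d v) ×-dec (hadj C (a v) (palette (a v) i) v (palette v x) Bool.≟ true)

      conflict-adjacent : ∀ {v i x} → Conflict v i x → adj G (a v) v ≡ true
      conflict-adjacent {v} (1+j<dv , e) =
        hadj-true⇒adjacent C (<-depth⇒≢ (subst (_< d v) (sym (depth-a 1+j<dv)) 1+j<dv)) e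

      conflict-functional : ∀ {v i x y} → Conflict v i x → Conflict v i y → x ≡ y
      conflict-functional {v} c@(1+j<dv , e) (_ , e′) =
        palette-injective v (ℕ.<-trans (ℕ.n<1+n j) 1+j<dv)
          (matchingˡ C (a v) v (conflict-adjacent c) _ _ _ e e′)

      conflict-injective : ∀ {v i i′ x} → Conflict v i x → Conflict v i′ x → i ≡ i′
      conflict-injective {v} c@(1+j<dv , e) (_ , e′) =
        palette-injective (a v) (ℕ.≤-reflexive (sym (depth-a 1+j<dv)))
          (matchingʳ C (a v) v (conflict-adjacent c) _ _ _ e e′)

      matching : ∀ v → Σ[ f ∈ (Fin (suc h) → Fin (suc h)) ]
                         (Injective _≡_ _≡_ f × (∀ {i x} → Conflict v i x → f i ≡ x))
      matching v = extend-matching (conflict? v) conflict-functional conflict-injective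

    deleted : V → Fin (suc h) → Fin (suc h)
    deleted v = proj₁ (matching v)

    deletedAtMostOnce : ∀ v m → Σ[ i₀ ∈ Fin (suc h) ] (∀ i → i ≢ i₀ → deleted v i ≢ m)
    deletedAtMostOnce v m with Fin.any? (λ i → deleted v i Fin.≟ m)
    ... | yes (i₀ , i₀↦m) = i₀ , λ i i≢i₀ i↦m →
                              i≢i₀ (proj₁ (proj₂ (matching v)) (trans i↦m (sym i₀↦m)))
    ... | no ¬∃i↦m        = zero , λ i _ i↦m → ¬∃i↦m (i , i↦m)

    colour′ : Fin (suc h) → V → Fin k
    colour′ i v with d v ℕ.≟ suc j
    ... | yes _ = palette v i
    ... | no  _ = colour v

    palette′ : Fin (suc h) → V → Fin h → Fin k
    palette′ i v = palette v ∘ punchIn (deleted v i)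

    colour′-shallow : ∀ i v → d v ≤ j → colour′ i v ≡ colour v
    colour′-shallow i v dv≤j with d v ℕ.≟ suc j
    ... | yes dv≡1+j = ⊥-elim (ℕ.<⇒≱ (ℕ.≤-reflexive (sym dv≡1+j)) dv≤j)
    ... | no  _      = refl

    colour′-level : ∀ i v → d v ≡ suc j → colour′ i v ≡ palette v i
    colour′-level i v dv≡1+j with d v ℕ.≟ suc j
    ... | yes _     = refl
    ... | no dv≢1+j = ⊥-elim (dv≢1+j dv≡1+j)

    colour′-independent : ∀ i u v → d u ≤ suc j → d v ≤ suc j →
      hadj C u (colour′ i u) v (colour′ i v) ≡ false
    colour′-independent i u v du≤ dv≤ with d u ℕ.≟ suc j | d v ℕ.≟ suc j
    ... | no du≢  | no dv≢  = colour-independent u v (below du≤ du≢) (below dv≤ dv≢)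
    ... | no du≢  | yes dv≡ = palette-free u v (below du≤ du≢) (ℕ.≤-reflexive (sym dv≡)) i
    ... | yes du≡ | no dv≢  =
      trans (hsym C u _ v _) (palette-free v u (below dv≤ dv≢) (ℕ.≤-reflexive (sym du≡)) i)
    ... | yes du≡ | yes dv≡ with u Fin.≟ v
    ...   | yes refl = hirrefl C u (palette u i)
    ...   | no u≢v   =
      nonadj C u v u≢v (sameDepth⇒nonadjacent elim (trans du≡ (sym dv≡)) u≢v) _ _

    palette′-free : ∀ i u v → d u ≤ suc j → suc j < d v → ∀ m →
      hadj C u (colour′ i u) v (palette′ i v m) ≡ false
    palette′-free i u v du≤ 1+j<dv m with d u ℕ.≟ suc j
    ... | no du≢  = palette-free u v (below du≤ du≢) (ℕ.<-trans (ℕ.n<1+n j) 1+j<dv) _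
    ... | yes du≡ with hadj C u (palette u i) v (palette′ i v m) in e
    ...   | false = refl
    ...   | true  = ⊥-elim (Fin.punchInᵢ≢i (deleted v i) m
                             (sym (proj₂ (proj₂ (matching v)) (1+j<dv , conflict))))
      where
      du<dv : d u < d v
      du<dv = subst (_< d v) (sym du≡) 1+j<dv
      uv : adj G u v ≡ true
      uv = hadj-true⇒adjacent C (<-depth⇒≢ du<dv) e
      u≡av : u ≡ a v
      u≡av = subst (λ t → u ≡ ancestorAt t v) du≡ (shallowerNeighbour⇒ancestorAt elim uv du<dv)
      conflict : hadj C (a v) (palette (a v) i) v (palette′ i v m) ≡ true
      conflict = subst (λ w → hadj C w (palette w i) v (palette′ i v m) ≡ true) u≡av e

    palette′-injective : ∀ i v → suc j < d v → Injective _≡_ _≡_ (palette′ i v)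
    palette′-injective i v 1+j<dv =
      Fin.punchIn-injective (deleted v i) _ _ ∘ palette-injective v (ℕ.<-trans (ℕ.n<1+n j) 1+j<dv)

    next : Fin (suc h) → Stage (suc j) h
    next i = record
      { colour             = colour′ i
      ; palette            = palette′ i
      ; colour-independent = colour′-independent i
      ; palette-free       = palette′-free i
      ; palette-injective  = palette′-injective i
      }

    module _ (P : (i : Fin (suc h)) → UniformPacking (next i)) where

      private
        branch : Fin (suc h) → List (IndepTransversal C)
        branch i = transversals (P i)

        hits : V → Fin (suc h) → Fin (suc h) → ℕ
        hits v m i = count (picks v (palette v m)) (branch i)

      covers-level : ∀ v → d v ≡ suc j → ∀ m → h ! ≤ sum (hits v m)
      covers-level v dv≡1+j m = begin
        h !               ≡⟨ length≡ (P m) ⟨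
        length (branch m) ≡⟨ count-All (picks v (palette v m)) all-picks ⟨
        hits v m m        ≤⟨ ≤sum (hits v m) m ⟩
        sum (hits v m)    ∎
        where
        open ℕ.≤-Reasoning
        picks-m : ∀ {T} → Extends (suc j) (colour′ m) T → picks v (palette v m) T ≡ true
        picks-m {T} extends-T = picks-true {v} {palette v m} {T}
          (trans (extends-T v (ℕ.≤-reflexive dv≡1+j)) (colour′-level m v dv≡1+j))
        all-picks : All (λ T → picks v (palette v m) T ≡ true) (branch m)
        all-picks = All.map (λ {T} → picks-m {T}) (extends (P m))

      covers-deeper : (∀ v → d v ≤ suc j + h) → ∀ v → suc j < d v → ∀ m →
                      h ! ≤ sum (hits v m)
      covers-deeper bound v 1+j<dv m =
        ℕ.*-cancelˡ-≤ h {{<-≤-+⇒NonZero (suc j) 1+j<dv (bound v)}} (begin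
          h * h !                    ≤⟨ *≤sum-except (λ i → h * hits v m i) i₀ survives ⟩
          sum (λ i → h * hits v m i) ≡⟨ *-distribˡ-sum h (hits v m) ⟨
          h * sum (hits v m)         ∎)
        where
        open ℕ.≤-Reasoning
        i₀ = proj₁ (deletedAtMostOnce v m)
        survives : ∀ i → i ≢ i₀ → h ! ≤ h * hits v m i
        survives i i≢i₀ = subst (λ x → h ! ≤ h * count (picks v (palette v x)) (branch i))
                                (Fin.punchIn-punchOut i↛m) (covers (P i) v 1+j<dv (punchOut i↛m))
          where
          i↛m = proj₂ (deletedAtMostOnce v m) i i≢i₀

      glue : (∀ v → d v ≤ suc j + h) → UniformPacking S
      glue bound = record
        { transversals = concatᶠ branch
        ; length≡      = trans (length-concatᶠ branch) (sum-const (length ∘ branch) (length≡ ∘ P))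
        ; extends      = All-concatᶠ branch λ i →
                           All.map (λ {T} → extends-next i {T}) (extends (P i))
        ; covers       = covers-glued
        }
        where
        extends-next : ∀ i {T} → Extends (suc j) (colour′ i) T → Extends j colour T
        extends-next i extends-T v dv≤j =
          trans (extends-T v (ℕ.m≤n⇒m≤1+n dv≤j)) (colour′-shallow i v dv≤j)
        covers-glued : ∀ v → j < d v → ∀ m →
          suc h ! ≤ suc h * count (picks v (palette v m)) (concatᶠ branch)
        covers-glued v j<dv m rewrite count-concatᶠ (picks v (palette v m)) branch
          with d v ℕ.≟ suc j
        ... | yes dv≡1+j = ℕ.*-monoʳ-≤ (suc h) (covers-level v dv≡1+j m)
        ... | no dv≢1+j  =
          ℕ.*-monoʳ-≤ (suc h) (covers-deeper bound v (ℕ.≤∧≢⇒< j<dv (dv≢1+j ∘ sym)) m)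

  packing : ∀ h {j} → (∀ v → d v ≤ j + h) → (S : Stage j h) → UniformPacking S
  packing zero {j} bound S = record
    { transversals = [ transversal ]
    ; length≡      = refl
    ; extends      = (λ v _ → refl) ∷ []
    ; covers       = λ v j<dv → ⊥-elim (ℕ.<⇒≱ j<dv (shallow v))
    }
    where
    open Stage S
    shallow : ∀ v → d v ≤ j
    shallow v = subst (d v ≤_) (ℕ.+-identityʳ j) (bound v)
    transversal : IndepTransversal C
    transversal = colour , λ u v → colour-independent u v (shallow u) (shallow v)
  packing (suc h) {j} bound S = glue (λ i → packing h bound′ (next i)) bound′
    where
    open Next S
    bound′ : ∀ v → d v ≤ suc j + h
    bound′ v = subst (d v ≤_) (ℕ.+-suc j h) (bound v)

  -- No vertex has depth 0.
  initial : HeightAtMost F k → Stage 0 k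
  initial height = record
    { colour             = λ v → fromℕ< (ℕ.≤-trans (depth-pos v) (height v))
    ; palette            = λ v → id
    ; colour-independent = λ u v du≤0 → ⊥-elim (ℕ.<⇒≱ (depth-pos u) du≤0)
    ; palette-free       = λ u v du≤0 → ⊥-elim (ℕ.<⇒≱ (depth-pos u) du≤0)
    ; palette-injective  = λ v _ → id
    }

everyCoverPacks : ∀ {G k} → TreedepthAtMost G k → EveryCoverPacks G k
everyCoverPacks {G} {k} (F , elim , height) C =
  uniform transversals {{nonZero}} , λ v i →
    1≤n*Prob-uniform transversals {{nonZero}} (picks v i) k
      (subst (_≤ k * count (picks v i) transversals) (sym length≡) (covers v (depth-pos v) i))
  where
  open EliminationForest F using (depth-pos)
  open LevelPacking C F elim
  open UniformPacking (packing k height (initial height))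
  nonZero : NonZero (length transversals)
  nonZero = subst NonZero (sym length≡) (k ℕ.!≢0)

≡ᵇ-true⇒≡ : ∀ {m n} → (m ≡ᵇ n) ≡ true → m ≡ n
≡ᵇ-true⇒≡ {m} {n} e = ℕ.≡ᵇ⇒≡ m n (subst T (sym e) _)

module ListCover (G : Graph) {k : ℕ} (LA : ListAssignment G k) where

  private
    V = Fin (n G)
    L = proj₁ LA
    L-injective = proj₂ LA

  hadjᴸ : V → Fin k → V → Fin k → Bool
  hadjᴸ u i v j with u Fin.≟ v
  ... | yes _ = not (does (i Fin.≟ j))
  ... | no  _ = adj G u v ∧ (L u i ≡ᵇ L v j)

  hadjᴸ-adjacent : ∀ {u v} → adj G u v ≡ true → ∀ i j → hadjᴸ u i v j ≡ (L u i ≡ᵇ L v j)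
  hadjᴸ-adjacent {u} {v} uv i j with u Fin.≟ v
  ... | yes u≡v = ⊥-elim (adjacent⇒distinct G uv u≡v)
  ... | no  _ rewrite uv = refl

  hadjᴸ-true⇒≡ : ∀ {u v} → adj G u v ≡ true → ∀ {i j} →
    hadjᴸ u i v j ≡ true → L u i ≡ L v j
  hadjᴸ-true⇒≡ uv {i} {j} e = ≡ᵇ-true⇒≡ (trans (sym (hadjᴸ-adjacent uv i j)) e)

  hadjᴸ-sym : ∀ u i v j → hadjᴸ u i v j ≡ hadjᴸ v j u i
  hadjᴸ-sym u i v j with u Fin.≟ v | v Fin.≟ u
  ... | yes _   | yes _   = cong not (does-⇔ (mk⇔ sym sym) (i Fin.≟ j) (j Fin.≟ i))
  ... | no  _   | no  _   =
    cong₂ _∧_ (Graph.sym G u v) (does-⇔ (mk⇔ sym sym) (L u i ℕ.≟ L v j) (L v j ℕ.≟ L u i))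
  ... | yes u≡v | no  v≢u = ⊥-elim (v≢u (sym u≡v))
  ... | no  u≢v | yes v≡u = ⊥-elim (u≢v (sym v≡u))

  hadjᴸ-irrefl : ∀ v i → hadjᴸ v i v i ≡ false
  hadjᴸ-irrefl v i with v Fin.≟ v
  ... | yes _   = cong not (dec-true (i Fin.≟ i) refl)
  ... | no  v≢v = ⊥-elim (v≢v refl)

  hadjᴸ-clique : ∀ v i j → i ≢ j → hadjᴸ v i v j ≡ true
  hadjᴸ-clique v i j i≢j with v Fin.≟ v
  ... | yes _   = cong not (dec-false (i Fin.≟ j) i≢j)
  ... | no  v≢v = ⊥-elim (v≢v refl)

  hadjᴸ-nonadj : ∀ u v → u ≢ v → adj G u v ≡ false → ∀ i j → hadjᴸ u i v j ≡ false
  hadjᴸ-nonadj u v u≢v uv i j with u Fin.≟ v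
  ... | yes u≡v = ⊥-elim (u≢v u≡v)
  ... | no  _ rewrite uv = refl

  cover : Cover G k
  cover = record
    { hadj      = hadjᴸ
    ; hsym      = hadjᴸ-sym
    ; hirrefl   = hadjᴸ-irrefl
    ; clique    = hadjᴸ-clique
    ; nonadj    = hadjᴸ-nonadj
    ; matchingˡ = λ u v uv i j j′ e e′ →
        L-injective v j j′ (trans (sym (hadjᴸ-true⇒≡ uv e)) (hadjᴸ-true⇒≡ uv e′))
    ; matchingʳ = λ u v uv i i′ j e e′ →
        L-injective u i i′ (trans (hadjᴸ-true⇒≡ uv e) (sym (hadjᴸ-true⇒≡ uv e′)))
    }

  colouring : IndepTransversal cover → ProperLColouring G LA
  colouring (t , independent) = (λ v → L v (t v)) , (λ v → t v , refl) , proper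
    where
    proper : ∀ u v → adj G u v ≡ true → L u (t u) ≢ L v (t v)
    proper u v uv same with trans (sym (independent u v))
                                  (trans (hadjᴸ-adjacent uv (t u) (t v))
                                         (dec-true (L u (t u) ℕ.≟ L v (t v)) same))
    ... | ()

  colouring-picks : ∀ v i (T : IndepTransversal cover) →
    (proj₁ (colouring T) v ≡ᵇ L v i) ≡ ⌊ proj₁ T v Fin.≟ i ⌋
  colouring-picks v i (t , _) =
    trans (does-⇔ (mk⇔ (L-injective v (t v) i) (cong (L v))) (L v (t v) ℕ.≟ L v i) (t v Fin.≟ i))
          (sym (isYes≗does (t v Fin.≟ i)))

weightedFlexChoosable : ∀ {G k} → TreedepthAtMost G k → (nz : NonZero k) →
  WeightedFlexChoosable G ((+ 1 / k) {{nz}}) k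
weightedFlexChoosable {G} {k} td nz LA@(L , _) = mapDist colouring D , λ v i →
  1≤n*p⇒1/n≤p k {{nz}} (subst (λ p → 1ℚ ≤ℚ ℕtoℚ k ℚ.* p)
    (sym (Prob-mapDist colouring D {E = λ c → proj₁ c v ≡ᵇ L v i} (colouring-picks v i)))
    (packs v i))
  where
  open ListCover G LA
  D = proj₁ (everyCoverPacks td cover)
  packs = proj₂ (everyCoverPacks td cover)

theorem2p2 : (G : Graph) (k : ℕ) → HasTreedepth G k →
    FracCorrPackingAtMost G k ×
    ((nz : NonZero k) → WeightedFlexChoosable G ((+ 1 / k) {{nz}}) k)
theorem2p2 G k (td , _) = (k , ℕ.≤-refl , everyCoverPacks td) , weightedFlexChoosable td
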